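{- Let $(S,\cdot)$ be a semigroup satisfying the Strong F\o lner Condition. If there is an element of $\Delta(S)$ which is right cancelable in $\beta S$, then $S$ is cancellative.
   Context: $S$ satisfies the Strong F\o lner Condition if for every finite nonempty $H\subseteq S$ and $\epsilon>0$ there is a finite nonempty $K\subseteq S$ with $|K\setminus sK|<\epsilon|K|$ for all $s\in H$. $d(A)$ is the supremum of $\alpha\in[0,1]$ such that for every finite nonempty $H$ and $\epsilon>0$ there is a finite nonempty $K$ with $|K\setminus sK|<\epsilon|K|$ for all $s\in H$ and $|A\cap K|\ge\alpha|K|$. $\beta S$ is the set of ultrafilters on $S$ with operation extending that of $S$ given by: $A\in pq$ iff $\{s\in S:s^{ -1}A\in q\}\in p$, where $s^{ -1}A=\{t:st\in A\}$. $\Delta(S)=\{p\in\beta S:d(A)>0$ for all $A\in p\}$. $p$ is right cancelable if $xp=yp$ implies $x=y$ for $x,y\in\beta S$. -}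

module Defs where

open import Level using (0ℓ)
open import Data.Nat using (ℕ; suc; _∸_)
open import Data.Fin using (Fin)
open import Data.Product using (Σ; ∃; _×_)
open import Data.Sum using (_⊎_)
open import Data.Integer using (+_)
open import Data.Rational using (ℚ; _/_; _*_; _<_; _≤_; Positive; 1ℚ)
open import Relation.Unary using (Pred; _⊆_; _∩_; ∁)
open import Relation.Nullary using (¬_)
open import Relation.Binary.PropositionalEquality using (_≡_)
open import Function.Definitions using (Injective)
open import Function.Bundles using (_⇔_)
open import Algebra.Core using (Op₂)

ℕ→ℚ : ℕ → ℚ
ℕ→ℚ n = (+ n) / 1

module _ {S : Set} (_·_ : Op₂ S) where

  -- A finite nonempty subset K of S, given by an injective enumeration
  -- K : Fin n → S with n ≥ 1.
  record FinSub : Set where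
    field
      size   : ℕ
      elem   : Fin (suc size) → S
      inj    : Injective _≡_ _≡_ elem

  open FinSub public

  card : FinSub → ℕ
  card K = suc (size K)

  _∈K_ : S → FinSub → Set
  t ∈K K = ∃ λ i → elem K i ≡ t

  InTranslate : S → FinSub → S → Set
  InTranslate s K t = ∃ λ i → s · elem K i ≡ t

  -- "K ∩ P has at least m elements": m distinct elements of K lying in P.
  AtLeastIn : FinSub → Pred S 0ℓ → ℕ → Set
  AtLeastIn K P m =
    Σ (Fin m → Fin (card K)) λ f → Injective _≡_ _≡_ f × (∀ j → P (elem K (f j)))

  -- |K \ sK| < ε|K|
  FolnerSmall : ℚ → S → FinSub → Set
  FolnerSmall ε s K =
    ∃ λ m → AtLeastIn K (InTranslate s K) m
          × ℕ→ℚ (card K ∸ m) < ε * ℕ→ℚ (card K)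

  DenseIn : ℚ → Pred S 0ℓ → FinSub → Set
  DenseIn α A K = ∃ λ m → AtLeastIn K A m × α * ℕ→ℚ (card K) ≤ ℕ→ℚ m

  -- Finite nonempty H ⊆ S given as a list Fin (suc h) → S.
  StrongFolner : Set
  StrongFolner =
    ∀ (h : ℕ) (H : Fin (suc h) → S) (ε : ℚ) → Positive ε →
      Σ FinSub λ K → ∀ i → FolnerSmall ε (H i) K

  -- α is admissible in the definition of d(A)
  DensityAdmissible : Pred S 0ℓ → ℚ → Set
  DensityAdmissible A α =
    ∀ (h : ℕ) (H : Fin (suc h) → S) (ε : ℚ) → Positive ε →
      Σ FinSub λ K → (∀ i → FolnerSmall ε (H i) K) × DenseIn α A K

  -- d(A) > 0, i.e. the supremum of admissible α ∈ [0,1] is positive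
  PositiveDensity : Pred S 0ℓ → Set
  PositiveDensity A = ∃ λ α → Positive α × α ≤ 1ℚ × DensityAdmissible A α

  record Ultrafilter : Set₁ where
    field
      _∈U     : Pred S 0ℓ → Set
      upward  : ∀ {A B : Pred S 0ℓ} → A ⊆ B → A ∈U → B ∈U
      inter   : ∀ {A B : Pred S 0ℓ} → A ∈U → B ∈U → (A ∩ B) ∈U
      full    : (λ _ → S) ∈U
      proper  : ¬ ((λ _ → Fin 0) ∈U)
      ultra   : ∀ (A : Pred S 0ℓ) → A ∈U ⊎ (∁ A) ∈U

  open Ultrafilter public

  _∈prod_,_ : Pred S 0ℓ → Ultrafilter → Ultrafilter → Set
  A ∈prod p , q = _∈U p (λ s → _∈U q (λ t → A (s · t)))

  SameUF : Ultrafilter → Ultrafilter → Set₁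
  SameUF x y = ∀ (A : Pred S 0ℓ) → _∈U x A ⇔ _∈U y A

  SameProd : Ultrafilter → Ultrafilter → Ultrafilter → Set₁
  SameProd x y p = ∀ (A : Pred S 0ℓ) → (A ∈prod x , p) ⇔ (A ∈prod y , p)

  RightCancelable : Ultrafilter → Set₁
  RightCancelable p = ∀ (x y : Ultrafilter) → SameProd x y p → SameUF x y

  InΔ : Ultrafilter → Set₁
  InΔ p = ∀ (A : Pred S 0ℓ) → _∈U p A → PositiveDensity A

  Cancellative : Set
  Cancellative =
    (∀ a b c → a · b ≡ a · c → b ≡ c) × (∀ a b c → b · a ≡ c · a → b ≡ c)

{-# OPTIONS --safe #-}
module Submission where

-- If b·t = c·t for p-almost every t, then bp = cp in βS (b, c principal), so
-- b = c by right cancelability of p. It therefore suffices to show that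
-- {t : b·t = c·t} ∈ p whenever b·a = c·a or a·b = a·c. Otherwise its complement
-- X has positive density α, so there are Følner sets K with |X ∩ K| ≥ α|K|.
--
-- If b·a = c·a, then b·t = c·t on aS, and aS ∈ p: a Følner set with
-- |K ∖ aK| < α|K| ≤ |X ∩ K| contains a point of X ∩ aK, impossible for X = S ∖ aS.
--
-- If a·b = a·c, take K Følner for a, b, c with ε = α/4. In K, fix for every
-- point of K ∩ aK one a-preimage in K; a is injective on these preimages, and
-- they miss fewer than ε|K| points of K. Counting the points x of K for which
-- b·x and c·x are such preimages, some x lies in X; but
-- a·(b·x) = (a·b)·x = (a·c)·x = a·(c·x) then forces b·x = c·x.
--
-- Constructively, principal ultrafilters need excluded middle, which p itself
-- provides: it contains λ _ → P or λ _ → ¬ P, and its members are inhabited.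

open import Level using (0ℓ)
open import Algebra.Core using (Op₂)
open import Algebra.Structures using (IsSemigroup)
open import Axiom.ExcludedMiddle using (ExcludedMiddle)
open import Data.Empty using (⊥-elim)
open import Data.Fin using (Fin; zero; suc)
open import Data.Fin.Properties using (suc-injective; injective⇒≤; _≟_; any?)
open import Data.Fin.Subset as Sub using (Subset; inside; outside; ∣_∣; _∈_; ⊤; Nonempty)
open import Data.Fin.Subset.Properties
  using (_∈?_; ∣∁p∣≡n∸∣p∣; ∣p∣≤n; ∣⊤∣≡n; x∈p∩q⁻; x∉p⇒x∈∁p; x∈∁p⇒x∉p)
import Data.Integer as ℤ
import Data.Integer.Properties as ℤ
open import Data.Nat using (ℕ; zero; suc; _+_; _∸_; _≤_; _<_; s≤s; z≤n)
open import Data.Nat.Coprimality as Coprime using (1-coprimeTo)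
open import Data.Nat.Properties
  using (≤-trans; ≤-<-trans; <-irrefl; m≤n⇒m≤1+n; +-suc; +-assoc; +-comm; +-mono-≤;
         +-monoʳ-≤; +-monoʳ-<; ∸-monoʳ-≤; m≤n+o⇒m∸n≤o; m≤n+m∸n; m∸n+n≡m; m+[n∸m]≡n;
         module ≤-Reasoning)
open import Data.Product using (Σ; ∃; _×_; _,_; proj₁; proj₂)
open import Data.Rational as ℚ using (½; Positive; mkℚ; *<*)
import Data.Rational.Properties as ℚ
open import Data.Sum using (inj₁; inj₂; [_,_]′)
open import Data.Vec using ([]; _∷_; here; there; lookup)
open import Function using (id; _∘_)
open import Function.Bundles using (mk⇔; Equivalence)
open import Function.Definitions using (Injective)
open import Relation.Binary.PropositionalEquality
open import Relation.Nullary using (¬_; yes; no; does; contradiction)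
open import Relation.Nullary.Decidable using (_×-dec_; toSum)
open import Relation.Unary as U using (Pred; Decidable)

open import Defs

private
  variable
    m n : ℕ
    x : Fin n

m∸n+o<m : ∀ {m n o} → n ≤ m → o < n → (m ∸ n) + o < m
m∸n+o<m {m} {n} {o} n≤m o<n = subst ((m ∸ n) + o <_) (m∸n+n≡m n≤m) (+-monoʳ-< (m ∸ n) o<n)

m∸n≤m∸[n+o]+o : ∀ m n o → m ∸ n ≤ (m ∸ (n + o)) + o
m∸n≤m∸[n+o]+o m n o = m≤n+o⇒m∸n≤o m n (begin
  m                        ≤⟨ m≤n+m∸n m (n + o) ⟩
  n + o + (m ∸ (n + o))    ≡⟨ +-assoc n o _ ⟩
  n + (o + (m ∸ (n + o)))  ≡⟨ cong (n +_) (+-comm o _) ⟩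
  n + ((m ∸ (n + o)) + o)  ∎)
  where open ≤-Reasoning

enumerate : (p : Subset n) → Fin ∣ p ∣ → Fin n
enumerate (inside  ∷ p) zero    = zero
enumerate (inside  ∷ p) (suc k) = suc (enumerate p k)
enumerate (outside ∷ p) k       = suc (enumerate p k)

enumerate-∈ : (p : Subset n) (k : Fin ∣ p ∣) → enumerate p k ∈ p
enumerate-∈ (inside  ∷ p) zero    = here
enumerate-∈ (inside  ∷ p) (suc k) = there (enumerate-∈ p k)
enumerate-∈ (outside ∷ p) k       = there (enumerate-∈ p k)

enumerate-injective : (p : Subset n) → Injective _≡_ _≡_ (enumerate p)
enumerate-injective (inside  ∷ p) {zero}  {zero}  _  = refl
enumerate-injective (inside  ∷ p) {suc k} {suc l} eq = cong suc (enumerate-injective p (suc-injective eq))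
enumerate-injective (outside ∷ p)                 eq = enumerate-injective p (suc-injective eq)

rank : (p : Subset n) → x ∈ p → Fin ∣ p ∣
rank (inside  ∷ p) here        = zero
rank (inside  ∷ p) (there x∈p) = suc (rank p x∈p)
rank (outside ∷ p) (there x∈p) = rank p x∈p

enumerate-rank : (p : Subset n) (x∈p : x ∈ p) → enumerate p (rank p x∈p) ≡ x
enumerate-rank (inside  ∷ p) here        = refl
enumerate-rank (inside  ∷ p) (there x∈p) = cong suc (enumerate-rank p x∈p)
enumerate-rank (outside ∷ p) (there x∈p) = cong suc (enumerate-rank p x∈p)

injective⇒∣p∣≤∣q∣ : {p : Subset m} {q : Subset n} (f : Fin m → Fin n) → Injective _≡_ _≡_ f →
                    (∀ {j} → j ∈ p → f j ∈ q) → ∣ p ∣ ≤ ∣ q ∣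
injective⇒∣p∣≤∣q∣ {p = p} {q} f f-inj f[p]⊆q = injective⇒≤ {f = φ} φ-injective
  where
  φ : Fin ∣ p ∣ → Fin ∣ q ∣
  φ k = rank q (f[p]⊆q (enumerate-∈ p k))

  φ-injective : Injective _≡_ _≡_ φ
  φ-injective {k} {l} φk≡φl = enumerate-injective p (f-inj (begin
    f (enumerate p k)  ≡⟨ enumerate-rank q _ ⟨
    enumerate q (φ k)  ≡⟨ cong (enumerate q) φk≡φl ⟩
    enumerate q (φ l)  ≡⟨ enumerate-rank q _ ⟩
    f (enumerate p l)  ∎))
    where open ≡-Reasoning

∣∁p∣<n⇒Nonempty : (p : Subset n) → ∣ Sub.∁ p ∣ < n → Nonempty p
∣∁p∣<n⇒Nonempty {n} p ∣∁p∣<n with ∣ p ∣ in ∣p∣≡ | enumerate p | enumerate-∈ p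
... | zero  | _ | _   =
  contradiction (subst (_< n) (trans (∣∁p∣≡n∸∣p∣ p) (cong (n ∸_) ∣p∣≡)) ∣∁p∣<n) (<-irrefl refl)
... | suc _ | e | e∈p = e zero , e∈p zero

∣p∣+∣∁p∣≡n : (p : Subset n) → ∣ p ∣ + ∣ Sub.∁ p ∣ ≡ n
∣p∣+∣∁p∣≡n p = trans (cong (∣ p ∣ +_) (∣∁p∣≡n∸∣p∣ p)) (m+[n∸m]≡n (∣p∣≤n p))

∣∁[p∩q]∣≤∣∁p∣+∣∁q∣ : (p q : Subset n) → ∣ Sub.∁ (p Sub.∩ q) ∣ ≤ ∣ Sub.∁ p ∣ + ∣ Sub.∁ q ∣
∣∁[p∩q]∣≤∣∁p∣+∣∁q∣ []            []            = z≤n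
∣∁[p∩q]∣≤∣∁p∣+∣∁q∣ (inside  ∷ p) (inside  ∷ q) = ∣∁[p∩q]∣≤∣∁p∣+∣∁q∣ p q
∣∁[p∩q]∣≤∣∁p∣+∣∁q∣ (inside  ∷ p) (outside ∷ q) =
  subst (suc ∣ Sub.∁ (p Sub.∩ q) ∣ ≤_) (sym (+-suc ∣ Sub.∁ p ∣ ∣ Sub.∁ q ∣))
        (s≤s (∣∁[p∩q]∣≤∣∁p∣+∣∁q∣ p q))
∣∁[p∩q]∣≤∣∁p∣+∣∁q∣ (outside ∷ p) (inside  ∷ q) = s≤s (∣∁[p∩q]∣≤∣∁p∣+∣∁q∣ p q)
∣∁[p∩q]∣≤∣∁p∣+∣∁q∣ (outside ∷ p) (outside ∷ q) =
  s≤s (subst (∣ Sub.∁ (p Sub.∩ q) ∣ ≤_) (sym (+-suc ∣ Sub.∁ p ∣ ∣ Sub.∁ q ∣))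
             (m≤n⇒m≤1+n (∣∁[p∩q]∣≤∣∁p∣+∣∁q∣ p q)))

toSubset : {P : Pred (Fin n) 0ℓ} → Decidable P → Subset n
toSubset {zero}  P? = []
toSubset {suc n} P? = does (P? zero) ∷ toSubset (P? ∘ suc)

∈-toSubset⁺ : {P : Pred (Fin n) 0ℓ} (P? : Decidable P) → P x → x ∈ toSubset P?
∈-toSubset⁺ {x = zero} P? px with P? zero
... | yes _  = here
... | no ¬px = contradiction px ¬px
∈-toSubset⁺ {x = suc x} P? px = there (∈-toSubset⁺ (P? ∘ suc) px)

∈-toSubset⁻ : {P : Pred (Fin n) 0ℓ} (P? : Decidable P) → x ∈ toSubset P? → P x
∈-toSubset⁻ {x = zero}  P? x∈ with P? zero | x∈
... | yes px | _ = px
∈-toSubset⁻ {x = suc x} P? (there x∈) = ∈-toSubset⁻ (P? ∘ suc) x∈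

image : (Fin m → Fin n) → Subset m → Subset n
image g r = toSubset (λ i → any? (λ j → j ∈? r ×-dec g j ≟ i))

preimage : (Fin m → Fin n) → Subset n → Subset m
preimage f a = toSubset (λ j → f j ∈? a)

range : (Fin m → Fin n) → Subset n
range g = image g ⊤

∈-image⁺ : {r : Subset m} (g : Fin m → Fin n) {j : Fin m} → j ∈ r → g j ∈ image g r
∈-image⁺ g {j} j∈r = ∈-toSubset⁺ _ (j , j∈r , refl)

∈-image⁻ : {r : Subset m} (g : Fin m → Fin n) {i : Fin n} → i ∈ image g r → ∃ λ j → j ∈ r × g j ≡ i
∈-image⁻ g = ∈-toSubset⁻ _

∣∁image∣≤n∸∣r∣ : {r : Subset m} (g : Fin m → Fin n) → Injective _≡_ _≡_ g →
                 ∣ Sub.∁ (image g r) ∣ ≤ n ∸ ∣ r ∣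
∣∁image∣≤n∸∣r∣ {n = n} {r = r} g g-inj = begin
  ∣ Sub.∁ (image g r) ∣  ≡⟨ ∣∁p∣≡n∸∣p∣ (image g r) ⟩
  n ∸ ∣ image g r ∣      ≤⟨ ∸-monoʳ-≤ n (injective⇒∣p∣≤∣q∣ g g-inj (∈-image⁺ g)) ⟩
  n ∸ ∣ r ∣              ∎
  where open ≤-Reasoning

∣∁range∣≤n∸m : (g : Fin m → Fin n) → Injective _≡_ _≡_ g → ∣ Sub.∁ (range g) ∣ ≤ n ∸ m
∣∁range∣≤n∸m {m} {n} g g-inj =
  subst (λ k → ∣ Sub.∁ (range g) ∣ ≤ n ∸ k) (∣⊤∣≡n m) (∣∁image∣≤n∸∣r∣ g g-inj)

∣∁image∘preimage∣≤n∸m+∣∁a∣ : {a : Subset n} (f g : Fin m → Fin n) →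
                             Injective _≡_ _≡_ f → Injective _≡_ _≡_ g →
                             ∣ Sub.∁ (image g (preimage f a)) ∣ ≤ (n ∸ m) + ∣ Sub.∁ a ∣
∣∁image∘preimage∣≤n∸m+∣∁a∣ {n} {m} {a} f g f-inj g-inj = begin
  ∣ Sub.∁ (image g r) ∣                     ≤⟨ ∣∁image∣≤n∸∣r∣ g g-inj ⟩
  n ∸ ∣ r ∣                                 ≤⟨ m∸n≤m∸[n+o]+o n ∣ r ∣ ∣ Sub.∁ r ∣ ⟩
  (n ∸ (∣ r ∣ + ∣ Sub.∁ r ∣)) + ∣ Sub.∁ r ∣  ≡⟨ cong (λ k → (n ∸ k) + ∣ Sub.∁ r ∣) (∣p∣+∣∁p∣≡n r) ⟩
  (n ∸ m) + ∣ Sub.∁ r ∣                     ≤⟨ +-monoʳ-≤ (n ∸ m) ∣∁r∣≤∣∁a∣ ⟩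
  (n ∸ m) + ∣ Sub.∁ a ∣                     ∎
  where
  open ≤-Reasoning
  r = preimage f a

  ∣∁r∣≤∣∁a∣ : ∣ Sub.∁ r ∣ ≤ ∣ Sub.∁ a ∣
  ∣∁r∣≤∣∁a∣ = injective⇒∣p∣≤∣q∣ f f-inj λ j∈∁r →
    x∉p⇒x∈∁p (x∈∁p⇒x∉p j∈∁r ∘ ∈-toSubset⁺ (λ j → f j ∈? a))

ℕ→ℚ≡mkℚ : ∀ n → ℕ→ℚ n ≡ mkℚ (ℤ.+ n) 0 (Coprime.sym (1-coprimeTo n))
ℕ→ℚ≡mkℚ n = ℚ.normalize-coprime (Coprime.sym (1-coprimeTo n))

ℕ→ℚ-+ : ∀ m n → ℕ→ℚ (m + n) ≡ ℕ→ℚ m ℚ.+ ℕ→ℚ n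
ℕ→ℚ-+ m n rewrite ℕ→ℚ≡mkℚ m | ℕ→ℚ≡mkℚ n =
  sym (cong₂ (λ i j → (i ℤ.+ j) ℚ./ 1) (ℤ.*-identityʳ (ℤ.+ m)) (ℤ.*-identityʳ (ℤ.+ n)))

ℕ→ℚ-cancel-< : ∀ {m n} → ℕ→ℚ m ℚ.< ℕ→ℚ n → m < n
ℕ→ℚ-cancel-< {m} {n} m<n rewrite ℕ→ℚ≡mkℚ m | ℕ→ℚ≡mkℚ n with m<n
... | *<* m*1<n*1 = ℤ.drop‿+<+ (subst₂ ℤ._<_ (ℤ.*-identityʳ (ℤ.+ m)) (ℤ.*-identityʳ (ℤ.+ n)) m*1<n*1)

ℕ→ℚ-suc-pos : ∀ n → Positive (ℕ→ℚ (suc n))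
ℕ→ℚ-suc-pos n = ℚ.normalize-pos (suc n) 1

½*p+½*p≡p : ∀ p → ½ ℚ.* p ℚ.+ ½ ℚ.* p ≡ p
½*p+½*p≡p p = trans (sym (ℚ.*-distribʳ-+ p ½ ½)) (ℚ.*-identityˡ p)

pos⇒½*pos : ∀ p → Positive p → Positive (½ ℚ.* p)
pos⇒½*pos p p>0 = ℚ.pos*pos⇒pos ½ p {{p>0}}

ℕ→ℚ-+-< : ∀ {a b} {x y N} → ℕ→ℚ a ℚ.< x ℚ.* N → ℕ→ℚ b ℚ.< y ℚ.* N → ℕ→ℚ (a + b) ℚ.< (x ℚ.+ y) ℚ.* N
ℕ→ℚ-+-< {a} {b} {x} {y} {N} a<xN b<yN =
  subst₂ ℚ._<_ (sym (ℕ→ℚ-+ a b)) (sym (ℚ.*-distribʳ-+ N x y)) (ℚ.+-mono-< a<xN b<yN)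

ℕ→ℚ-+-<-halves : ∀ α {N} a b → ℕ→ℚ a ℚ.< ½ ℚ.* α ℚ.* N → ℕ→ℚ b ℚ.< ½ ℚ.* α ℚ.* N →
                 ℕ→ℚ (a + b) ℚ.< α ℚ.* N
ℕ→ℚ-+-<-halves α {N} a b a< b< =
  subst (λ x → ℕ→ℚ (a + b) ℚ.< x ℚ.* N) (½*p+½*p≡p α) (ℕ→ℚ-+-< {a} {b} {½ ℚ.* α} {½ ℚ.* α} {N} a< b<)

ℕ→ℚ-+-<-quarters : ∀ α {N} a b c → let ε = ½ ℚ.* (½ ℚ.* α) in
                   ℕ→ℚ a ℚ.< ε ℚ.* N → ℕ→ℚ b ℚ.< ε ℚ.* N → ℕ→ℚ c ℚ.< ε ℚ.* N →
                   ℕ→ℚ ((b + a) + (c + a)) ℚ.< α ℚ.* N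
ℕ→ℚ-+-<-quarters α a b c a< b< c< =
  ℕ→ℚ-+-<-halves α (b + a) (c + a) (ℕ→ℚ-+-<-halves (½ ℚ.* α) b a b< a<)
                                   (ℕ→ℚ-+-<-halves (½ ℚ.* α) c a c< a<)

module FolnerSet {S : Set} {_·_ : Op₂ S} (K : FinSub _·_) where

  private
    ∣K∣ : ℕ
    ∣K∣ = card _·_ K

  record AllButAtMost (d : ℕ) (P : Pred S 0ℓ) : Set where
    field
      indices : Subset ∣K∣
      missing : ∣ Sub.∁ indices ∣ ≤ d
      sound   : ∀ {i} → i ∈ indices → P (elem K i)

  open AllButAtMost

  atLeastIn⇒AllButAtMost : ∀ {P m} → AtLeastIn _·_ K P m → AllButAtMost (∣K∣ ∸ m) P
  atLeastIn⇒AllButAtMost {P} (f , f-inj , f∈P) = record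
    { indices = range f
    ; missing = ∣∁range∣≤n∸m f f-inj
    ; sound   = λ i∈range → let j , _ , fj≡i = ∈-image⁻ f i∈range in subst (P ∘ elem K) fj≡i (f∈P j)
    }

  AllButAtMost-∩ : ∀ {d e P Q} → AllButAtMost d P → AllButAtMost e Q → AllButAtMost (d + e) (P U.∩ Q)
  AllButAtMost-∩ P′ Q′ = record
    { indices = indices P′ Sub.∩ indices Q′
    ; missing = ≤-trans (∣∁[p∩q]∣≤∣∁p∣+∣∁q∣ (indices P′) (indices Q′)) (+-mono-≤ (missing P′) (missing Q′))
    ; sound   = λ i∈ → let i∈P , i∈Q = x∈p∩q⁻ (indices P′) (indices Q′) i∈ in sound P′ i∈P , sound Q′ i∈Q
    }

  AllButAtMost⇒inhabited : ∀ {d P} → AllButAtMost d P → d < ∣K∣ → ∃ P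
  AllButAtMost⇒inhabited P′ d<∣K∣ =
    let i , i∈ = ∣∁p∣<n⇒Nonempty (indices P′) (≤-<-trans (missing P′) d<∣K∣) in elem K i , sound P′ i∈

  Overlap : S → ℕ → Set
  Overlap s = AtLeastIn _·_ K (InTranslate _·_ s K)

  -- A chosen preimage in K of the j-th listed point of K ∩ sK.
  source : ∀ {s m} → Overlap s m → Fin m → Fin ∣K∣
  source (_ , _ , f∈sK) j = proj₁ (f∈sK j)

  source-translates : ∀ {s m} (O : Overlap s m) j → s · elem K (source O j) ≡ elem K (proj₁ O j)
  source-translates (_ , _ , f∈sK) j = proj₂ (f∈sK j)

  source-injective : ∀ {s m} (O : Overlap s m) → Injective _≡_ _≡_ (source O)
  source-injective {s} O@(f , f-inj , _) {j} {l} sj≡sl = f-inj (inj K (begin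
    elem K (f j)             ≡⟨ source-translates O j ⟨
    s · elem K (source O j)  ≡⟨ cong (λ i → s · elem K i) sj≡sl ⟩
    s · elem K (source O l)  ≡⟨ source-translates O l ⟩
    elem K (f l)             ∎))
    where open ≡-Reasoning

  Sources : ∀ {s m} → Overlap s m → Pred S 0ℓ
  Sources O y = ∃ λ u → elem K (source O u) ≡ y

  AllButAtMost-sources : ∀ {s m} (O : Overlap s m) → AllButAtMost (∣K∣ ∸ m) (Sources O)
  AllButAtMost-sources O = atLeastIn⇒AllButAtMost (source O , source-injective O , λ u → u , refl)

  sources-cancel : ∀ {s m y z} (O : Overlap s m) → Sources O y → Sources O z → s · y ≡ s · z → y ≡ z
  sources-cancel O@(f , f-inj , _) (u , refl) (v , refl) su≡sv =
    cong (elem K ∘ source O)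
         (f-inj (inj K (trans (sym (source-translates O u)) (trans su≡sv (source-translates O v)))))

  AllButAtMost-preimage : ∀ {s m d Q} → Overlap s m → AllButAtMost d Q →
                          AllButAtMost ((∣K∣ ∸ m) + d) (λ x → Q (s · x))
  AllButAtMost-preimage {s} {m} {Q = Q} O@(f , f-inj , _) Q′ = record
    { indices = image (source O) (preimage f (indices Q′))
    ; missing = ≤-trans (∣∁image∘preimage∣≤n∸m+∣∁a∣ f (source O) f-inj (source-injective O))
                        (+-monoʳ-≤ (∣K∣ ∸ m) (missing Q′))
    ; sound   = λ i∈ → let j , j∈ , sj≡i = ∈-image⁻ (source O) i∈ in
        subst (λ i → Q (s · elem K i)) sj≡i
              (subst Q (sym (source-translates O j)) (sound Q′ (∈-toSubset⁻ _ j∈)))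
    }

  cancellable-point : ∀ {a b c ma mb mc X mX} → Overlap a ma → Overlap b mb → Overlap c mc →
                      AtLeastIn _·_ K X mX → ((∣K∣ ∸ mb) + (∣K∣ ∸ ma)) + ((∣K∣ ∸ mc) + (∣K∣ ∸ ma)) < mX →
                      ∃ λ x → X x × (a · (b · x) ≡ a · (c · x) → b · x ≡ c · x)
  cancellable-point {_} {b} {c} {ma} {mb} {mc} {X} {mX} Oa Ob Oc X∩K@(g , g-inj , _) deficit<mX =
    let x , x∈X , bx∈ , cx∈ = AllButAtMost⇒inhabited candidates (m∸n+o<m (injective⇒≤ g-inj) deficit<mX)
    in  x , x∈X , sources-cancel Oa bx∈ cx∈
    where
    candidates : AllButAtMost ((∣K∣ ∸ mX) + (((∣K∣ ∸ mb) + (∣K∣ ∸ ma)) + ((∣K∣ ∸ mc) + (∣K∣ ∸ ma))))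
                              (X U.∩ ((λ x → Sources Oa (b · x)) U.∩ (λ x → Sources Oa (c · x))))
    candidates = AllButAtMost-∩ (atLeastIn⇒AllButAtMost X∩K)
                   (AllButAtMost-∩ (AllButAtMost-preimage Ob (AllButAtMost-sources Oa))
                                   (AllButAtMost-preimage Oc (AllButAtMost-sources Oa)))

  dense⇒inhabited : ∀ {X α} → Positive α → DenseIn _·_ α X K → ∃ X
  dense⇒inhabited {α = α} α>0 (zero , _ , αN≤0) =
    ⊥-elim (ℚ.<-irrefl refl (ℚ.<-≤-trans (ℚ.positive⁻¹ _ {{αN>0}}) αN≤0))
    where
    αN>0 : Positive (α ℚ.* ℕ→ℚ ∣K∣)
    αN>0 = ℚ.pos*pos⇒pos α {{α>0}} (ℕ→ℚ ∣K∣) {{ℕ→ℚ-suc-pos (size K)}}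
  dense⇒inhabited α>0 (suc _ , (f , _ , f∈X) , _) = elem K (f zero) , f∈X zero

  folner-meets-dense : ∀ {s X α} → FolnerSmall _·_ α s K → DenseIn _·_ α X K →
                       ∃ λ t → X t × InTranslate _·_ s K t
  folner-meets-dense (m , O , ∣K∣∸m<αN) (mX , X∩K@(g , g-inj , _) , αN≤mX) =
    AllButAtMost⇒inhabited (AllButAtMost-∩ (atLeastIn⇒AllButAtMost X∩K) (atLeastIn⇒AllButAtMost O))
      (m∸n+o<m (injective⇒≤ g-inj) (ℕ→ℚ-cancel-< {∣K∣ ∸ m} {mX} (ℚ.<-≤-trans ∣K∣∸m<αN αN≤mX)))

  folner-cancellable-point : ∀ {a b c X α} →
                             (∀ i → FolnerSmall _·_ (½ ℚ.* (½ ℚ.* α)) (lookup (a ∷ b ∷ c ∷ []) i) K) →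
                             DenseIn _·_ α X K → ∃ λ x → X x × (a · (b · x) ≡ a · (c · x) → b · x ≡ c · x)
  folner-cancellable-point {α = α} small (mX , X∩K , αN≤mX) =
    let ma , Oa , ∣K∣∸ma<εN = small zero
        mb , Ob , ∣K∣∸mb<εN = small (suc zero)
        mc , Oc , ∣K∣∸mc<εN = small (suc (suc zero))
        deficit<αN = ℕ→ℚ-+-<-quarters α (∣K∣ ∸ ma) (∣K∣ ∸ mb) (∣K∣ ∸ mc) ∣K∣∸ma<εN ∣K∣∸mb<εN ∣K∣∸mc<εN
    in  cancellable-point Oa Ob Oc X∩K
          (ℕ→ℚ-cancel-< {((∣K∣ ∸ mb) + (∣K∣ ∸ ma)) + ((∣K∣ ∸ mc) + (∣K∣ ∸ ma))} {mX}
                        (ℚ.<-≤-trans deficit<αN αN≤mX))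

module _ {S : Set} {_·_ : Op₂ S} where

  positiveDensity⇒inhabited : ∀ {A} → S → PositiveDensity _·_ A → ∃ A
  positiveDensity⇒inhabited s (α , α>0 , _ , admissible) =
    let K , _ , dense = admissible 0 (λ _ → s) α α>0 in FolnerSet.dense⇒inhabited K {α = α} α>0 dense

  excludedMiddle : (p : Ultrafilter _·_) → (∀ {A} → _∈U p A → ∃ A) → ExcludedMiddle 0ℓ
  excludedMiddle p inhabited {P} with ultra p (λ _ → P)
  ... | inj₁ P∈p  = yes (proj₂ (inhabited P∈p))
  ... | inj₂ ¬P∈p = no (proj₂ (inhabited ¬P∈p))

  principal : ExcludedMiddle 0ℓ → S → Ultrafilter _·_
  principal em s = record
    { _∈U    = λ A → A s
    ; upward = λ A⊆B → A⊆B
    ; inter  = _,_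
    ; full   = s
    ; proper = λ ()
    ; ultra  = λ A → toSum em
    }

module Cancellation {S : Set} {_·_ : Op₂ S} (isSemigroup : IsSemigroup _≡_ _·_)
  (p : Ultrafilter _·_) (p∈Δ : InΔ _·_ p) (p-rc : RightCancelable _·_ p) where

  open IsSemigroup isSemigroup using (assoc)
  open Ultrafilter p using () renaming (_∈U to _∈p)

  ∈p-unless-co-dense : ∀ A → ¬ PositiveDensity _·_ (U.∁ A) → A ∈p
  ∈p-unless-co-dense A ∁A-not-dense =
    [ id , (λ ∁A∈p → contradiction (p∈Δ _ ∁A∈p) ∁A-not-dense) ]′ (ultra p A)

  ≡-on-p⇒≡ : ∀ b c → (λ t → b · t ≡ c · t) ∈p → b ≡ c
  ≡-on-p⇒≡ b c bt≡ct∈p = sym (Equivalence.to (p-rc (δ b) (δ c) bp≡cp (_≡ b)) refl)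
    where
    δ : S → Ultrafilter _·_
    δ = principal (excludedMiddle p λ A∈p → positiveDensity⇒inhabited b (p∈Δ _ A∈p))

    bp≡cp : SameProd _·_ (δ b) (δ c) p
    bp≡cp A = mk⇔ (λ bA∈p → upward p (λ (bt≡ct , bt∈A) → subst A bt≡ct bt∈A) (inter p bt≡ct∈p bA∈p))
                  (λ cA∈p → upward p (λ (bt≡ct , ct∈A) → subst A (sym bt≡ct) ct∈A) (inter p bt≡ct∈p cA∈p))

  _·S : S → Pred S 0ℓ
  (a ·S) t = ∃ λ s → a · s ≡ t

  ·S-not-co-dense : ∀ a → ¬ PositiveDensity _·_ (U.∁ (a ·S))
  ·S-not-co-dense a (α , α>0 , _ , admissible) =
    let K , small , dense = admissible 0 (λ _ → a) α α>0
        t , t∉aS , i , ai≡t = FolnerSet.folner-meets-dense K {X = U.∁ (a ·S)} {α} (small zero) dense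
    in  t∉aS (elem K i , ai≡t)

  right-cancel : ∀ a b c → b · a ≡ c · a → b ≡ c
  right-cancel a b c ba≡ca =
    ≡-on-p⇒≡ b c (upward p b[as]≡c[as] (∈p-unless-co-dense (a ·S) (·S-not-co-dense a)))
    where
    b[as]≡c[as] : ∀ {t} → (a ·S) t → b · t ≡ c · t
    b[as]≡c[as] (s , refl) = begin
      b · (a · s)  ≡⟨ assoc b a s ⟨
      (b · a) · s  ≡⟨ cong (_· s) ba≡ca ⟩
      (c · a) · s  ≡⟨ assoc c a s ⟩
      c · (a · s)  ∎
      where open ≡-Reasoning

  equalizer-not-co-dense : ∀ a b c → a · b ≡ a · c → ¬ PositiveDensity _·_ (U.∁ (λ t → b · t ≡ c · t))
  equalizer-not-co-dense a b c ab≡ac (α , α>0 , _ , admissible) =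
    let ε>0 = pos⇒½*pos (½ ℚ.* α) (pos⇒½*pos α α>0)
        K , small , dense = admissible 2 (lookup (a ∷ b ∷ c ∷ [])) (½ ℚ.* (½ ℚ.* α)) ε>0
        x , bx≢cx , a-cancels =
          FolnerSet.folner-cancellable-point K {X = U.∁ (λ t → b · t ≡ c · t)} {α} small dense
    in  bx≢cx (a-cancels (begin
          a · (b · x)  ≡⟨ assoc a b x ⟨
          (a · b) · x  ≡⟨ cong (_· x) ab≡ac ⟩
          (a · c) · x  ≡⟨ assoc a c x ⟩
          a · (c · x)  ∎))
    where open ≡-Reasoning

  left-cancel : ∀ a b c → a · b ≡ a · c → b ≡ c
  left-cancel a b c ab≡ac =
    ≡-on-p⇒≡ b c (∈p-unless-co-dense (λ t → b · t ≡ c · t) (equalizer-not-co-dense a b c ab≡ac))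

corollary3p12 : {S : Set} (_·_ : Op₂ S) → IsSemigroup _≡_ _·_ →
    StrongFolner _·_ →
    Σ (Ultrafilter _·_) (λ p → InΔ _·_ p × RightCancelable _·_ p) →
    Cancellative _·_
corollary3p12 _·_ isSemigroup _ (p , p∈Δ , p-rc) = left-cancel , right-cancel
  where open Cancellation isSemigroup p p∈Δ p-rc
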